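{- For $n\ge1$ let $c_{asc}(n)$ be as defined in the context. Then for every integer $m\ge1$, $$c_{asc}(2m)=2c_{asc}(m),\qquad c_{asc}(2m+1)=2c_{asc}(m)+2m-1.$$
   Context: Write $n=\sum_{i=1}^{\omega(n)}2^{\rho_i}$ with $\rho_{\omega(n)}>\dots>\rho_1\ge0$. A full binary tree is a rooted tree in which every node has $0$ or $2$ children; a ladder tree is one in which every internal node has at least one leaf child. A perfect binary tree with $2^j$ leaves has all its leaves at depth $j$. The ascending MinD tree on $n$ leaves is obtained from the ladder tree with $\omega(n)$ leaves by replacing its leaves with perfect trees so that the perfect tree with $2^{\rho_1}$ leaves is a child of the root, the perfect tree with $2^{\rho_2}$ leaves is on the next rung down, and so on, with the perfect trees with $2^{\rho_{\omega(n)-1}}$ and $2^{\rho_{\omega(n)}}$ leaves as the two children of the lowest internal node of the ladder (if $\omega(n)=1$ it is just the perfect tree with $n$ leaves). $c_{asc}(n)$ is its Colless index, where the Colless index of a full binary tree is $\sum|\ell_L(v)-\ell_R(v)|$ over internal nodes $v$, with $\ell_L(v),\ell_R(v)$ the numbers of leaves in the left and right subtrees of $v$. -}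

module Defs where

open import Data.Nat using (ℕ; zero; suc; _+_; _*_; _/_; _%_; ∣_-_∣)
open import Data.List using (List; []; _∷_)
open import Data.Bool using (if_then_else_)
open import Data.Nat using (_≡ᵇ_)

data Tree : Set where
  leaf : Tree
  node : Tree → Tree → Tree

leaves : Tree → ℕ
leaves leaf       = 1
leaves (node l r) = leaves l + leaves r

colless : Tree → ℕ
colless leaf       = 0
colless (node l r) = ∣ leaves l - leaves r ∣ + colless l + colless r

perfect : ℕ → Tree
perfect zero    = leaf
perfect (suc j) = node (perfect j) (perfect j)

-- exponents of the binary expansion of n, in ascending order
-- (fuel-based; fuel n suffices since n halves at each step)
expsAux : ℕ → ℕ → ℕ → List ℕ
expsAux zero    k n = []
expsAux (suc f) k n =
  if n ≡ᵇ 0 then []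
  else (if n % 2 ≡ᵇ 1 then k ∷ expsAux f (suc k) (n / 2)
        else expsAux f (suc k) (n / 2))

exps : ℕ → List ℕ
exps n = expsAux n 0 n

-- ladder with perfect trees hung on it: first exponent is a child of the root,
-- the last two are the two children of the lowest internal node
ladder : List ℕ → Tree
ladder []           = leaf   -- unused (n = 0)
ladder (ρ ∷ [])     = perfect ρ
ladder (ρ ∷ σ ∷ rs) = node (perfect ρ) (ladder (σ ∷ rs))

ascMinD : ℕ → Tree
ascMinD n = ladder (exps n)

c-asc : ℕ → ℕ
c-asc n = colless (ascMinD n)

{-# OPTIONS --safe #-}
-- Writing n = 2m or n = 2m + 1, the binary expansion of n is that of m shifted up by
-- one, possibly preceded by the exponent 0. Raising every exponent of the ladder by one
-- replaces each leaf of the tree by a cherry, which doubles every leaf count and hence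
-- the Colless index. Prepending the exponent 0 hangs one leaf next to a subtree with 2m
-- leaves, adding the single imbalance 2m − 1.
module Submission where

open import Defs
open import Data.Nat using (ℕ; _+_; _*_; _∸_; _≤_)
open import Data.Product using (_×_)
open import Relation.Binary.PropositionalEquality using (_≡_)

open import Data.Nat using (zero; suc; _/_; _%_; ∣_-_∣; _≡ᵇ_; _<_; _^_; s≤s; z≤n)
open import Data.Nat.Properties
open import Data.Nat.DivMod using (m*n%n≡0; m*n/n≡m; m/n<m; [m+kn]%n≡m%n; +-distrib-/-∣ʳ)
open import Data.Nat.Divisibility using (m∣m*n)
open import Data.Nat.Induction using (<-rec)
open import Data.List using (List; []; _∷_; map)
open import Data.Nat.ListAction using (sum)
open import Data.Bool using (true; false)
open import Data.Product using (_,_; ∃-syntax)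
open import Data.Sum using (_⊎_; inj₁; inj₂)
open import Data.Empty using (⊥-elim)
open import Relation.Binary.PropositionalEquality
  using (refl; cong; cong₂; sym; trans; _≢_; module ≡-Reasoning)
open ≡-Reasoning

even-or-odd : ∀ n → ∃[ k ] (n ≡ 2 * k ⊎ n ≡ 2 * k + 1)
even-or-odd zero = 0 , inj₁ refl
even-or-odd (suc n) with even-or-odd n
... | k , inj₁ refl = k , inj₂ (+-comm 1 (2 * k))
... | k , inj₂ refl = suc k , inj₁ (begin
  1 + (2 * k + 1)    ≡⟨ +-comm 1 (2 * k + 1) ⟩
  2 * k + 1 + 1      ≡⟨ +-assoc (2 * k) 1 1 ⟩
  2 * k + 2          ≡⟨ +-comm (2 * k) 2 ⟩
  2 + 2 * k          ≡⟨ *-distribˡ-+ 2 1 k ⟨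
  2 * suc k          ∎)

2m%2≡0 : ∀ m → 2 * m % 2 ≡ 0
2m%2≡0 m = trans (cong (_% 2) (*-comm 2 m)) (m*n%n≡0 m 2)

1+2m%2≡1 : ∀ m → (1 + 2 * m) % 2 ≡ 1
1+2m%2≡1 m = trans (cong (λ x → (1 + x) % 2) (*-comm 2 m)) ([m+kn]%n≡m%n 1 m 2)

2m/2≡m : ∀ m → 2 * m / 2 ≡ m
2m/2≡m m = trans (cong (_/ 2) (*-comm 2 m)) (m*n/n≡m m 2)

1+2m/2≡m : ∀ m → (1 + 2 * m) / 2 ≡ m
1+2m/2≡m m = trans (+-distrib-/-∣ʳ 1 (m∣m*n {2} m)) (2m/2≡m m)

m≤2m : ∀ m → m ≤ 2 * m
m≤2m m = m≤m+n m (m + 0)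

m≤2m∸1 : ∀ m → 1 ≤ m → m ≤ 2 * m ∸ 1
m≤2m∸1 (suc m) _ = ≤-trans (m≤n+m (suc m) m) (+-monoʳ-≤ m (s≤s (m≤m+n m 0)))

expsAux-suc-even : ∀ f k n → suc n % 2 ≡ 0 →
  expsAux (suc f) k (suc n) ≡ expsAux f (suc k) (suc n / 2)
expsAux-suc-even f k n even rewrite even = refl

expsAux-suc-odd : ∀ f k n → suc n % 2 ≡ 1 →
  expsAux (suc f) k (suc n) ≡ k ∷ expsAux f (suc k) (suc n / 2)
expsAux-suc-odd f k n odd rewrite odd = refl

expsAux-shift : ∀ f k n → expsAux f (suc k) n ≡ map suc (expsAux f k n)
expsAux-shift zero    k n       = refl
expsAux-shift (suc f) k zero    = refl
expsAux-shift (suc f) k (suc n) with suc n % 2 ≡ᵇ 1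
... | true  = cong (suc k ∷_) (expsAux-shift f (suc k) (suc n / 2))
... | false = expsAux-shift f (suc k) (suc n / 2)

expsAux-zero : ∀ f k → expsAux f k 0 ≡ []
expsAux-zero zero    k = refl
expsAux-zero (suc f) k = refl

half-≤-fuel : ∀ {n f} → suc n ≤ suc f → suc n / 2 ≤ f
half-≤-fuel {n} 1+n≤1+f = ≤-pred (≤-trans (m/n<m (suc n) 2 (s≤s (s≤s z≤n))) 1+n≤1+f)

expsAux-fuel-irrelevant : ∀ f g k n → n ≤ f → n ≤ g → expsAux f k n ≡ expsAux g k n
expsAux-fuel-irrelevant f       g       k zero    _   _   =
  trans (expsAux-zero f k) (sym (expsAux-zero g k))
expsAux-fuel-irrelevant (suc f) (suc g) k (suc n) n≤f n≤g with suc n % 2 ≡ᵇ 1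
... | true  = cong (k ∷_) (expsAux-fuel-irrelevant f g (suc k) (suc n / 2)
                             (half-≤-fuel n≤f) (half-≤-fuel n≤g))
... | false = expsAux-fuel-irrelevant f g (suc k) (suc n / 2)
                (half-≤-fuel n≤f) (half-≤-fuel n≤g)

expsAux-shift-refuel : ∀ f k n → n ≤ f → expsAux f (suc k) n ≡ map suc (expsAux n k n)
expsAux-shift-refuel f k n n≤f =
  trans (expsAux-shift f k n) (cong (map suc) (expsAux-fuel-irrelevant f n k n n≤f ≤-refl))

exps-2m : ∀ m → exps (2 * m) ≡ map suc (exps m)
exps-2m zero        = refl
exps-2m m@(suc _) = begin
  exps (2 * m)                        ≡⟨ expsAux-suc-even (2 * m ∸ 1) 0 (2 * m ∸ 1) (2m%2≡0 m) ⟩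
  expsAux (2 * m ∸ 1) 1 (2 * m / 2)   ≡⟨ cong (expsAux (2 * m ∸ 1) 1) (2m/2≡m m) ⟩
  expsAux (2 * m ∸ 1) 1 m             ≡⟨ expsAux-shift-refuel _ 0 m (m≤2m∸1 m (s≤s z≤n)) ⟩
  map suc (exps m)                    ∎

exps-2m+1 : ∀ m → exps (2 * m + 1) ≡ 0 ∷ map suc (exps m)
exps-2m+1 m rewrite +-comm (2 * m) 1 = begin
  exps (1 + 2 * m)                         ≡⟨ expsAux-suc-odd (2 * m) 0 (2 * m) (1+2m%2≡1 m) ⟩
  0 ∷ expsAux (2 * m) 1 ((1 + 2 * m) / 2)  ≡⟨ cong (λ x → 0 ∷ expsAux (2 * m) 1 x) (1+2m/2≡m m) ⟩
  0 ∷ expsAux (2 * m) 1 m                  ≡⟨ cong (0 ∷_) (expsAux-shift-refuel (2 * m) 0 m (m≤2m m)) ⟩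
  0 ∷ map suc (exps m)                     ∎

sumPow2 : List ℕ → ℕ
sumPow2 E = sum (map (2 ^_) E)

sumPow2-map-suc : ∀ E → sumPow2 (map suc E) ≡ 2 * sumPow2 E
sumPow2-map-suc []      = refl
sumPow2-map-suc (ρ ∷ E) = begin
  2 * 2 ^ ρ + sumPow2 (map suc E)   ≡⟨ cong (2 * 2 ^ ρ +_) (sumPow2-map-suc E) ⟩
  2 * 2 ^ ρ + 2 * sumPow2 E         ≡⟨ *-distribˡ-+ 2 (2 ^ ρ) _ ⟨
  2 * (2 ^ ρ + sumPow2 E)           ∎

sumPow2-exps : ∀ n → sumPow2 (exps n) ≡ n
sumPow2-exps = <-rec (λ n → sumPow2 (exps n) ≡ n) step
  where
  step : ∀ n → (∀ {k} → k < n → sumPow2 (exps k) ≡ k) → sumPow2 (exps n) ≡ n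
  step n rec with even-or-odd n
  ... | zero      , inj₁ refl = refl
  ... | k@(suc _) , inj₁ refl = begin
    sumPow2 (exps (2 * k))           ≡⟨ cong sumPow2 (exps-2m k) ⟩
    sumPow2 (map suc (exps k))       ≡⟨ sumPow2-map-suc (exps k) ⟩
    2 * sumPow2 (exps k)             ≡⟨ cong (2 *_) (rec (m<m+n k (s≤s z≤n))) ⟩
    2 * k                            ∎
  ... | k         , inj₂ refl = begin
    sumPow2 (exps (2 * k + 1))       ≡⟨ cong sumPow2 (exps-2m+1 k) ⟩
    1 + sumPow2 (map suc (exps k))   ≡⟨ cong suc (sumPow2-map-suc (exps k)) ⟩
    1 + 2 * sumPow2 (exps k)         ≡⟨ cong (λ x → 1 + 2 * x) (rec k<2k+1) ⟩
    1 + 2 * k                        ≡⟨ +-comm 1 (2 * k) ⟩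
    2 * k + 1                        ∎
    where
    k<2k+1 : k < 2 * k + 1
    k<2k+1 = ≤-trans (s≤s (m≤2m k)) (≤-reflexive (+-comm 1 (2 * k)))

double : Tree → Tree
double leaf       = node leaf leaf
double (node l r) = node (double l) (double r)

leaves-double : ∀ t → leaves (double t) ≡ 2 * leaves t
leaves-double leaf       = refl
leaves-double (node l r) =
  trans (cong₂ _+_ (leaves-double l) (leaves-double r)) (sym (*-distribˡ-+ 2 (leaves l) (leaves r)))

colless-double : ∀ t → colless (double t) ≡ 2 * colless t
colless-double leaf       = refl
colless-double (node l r) = begin
  ∣ leaves (double l) - leaves (double r) ∣ + colless (double l) + colless (double r)
    ≡⟨ cong₂ (λ x y → x + y + colless (double r))
             (cong₂ ∣_-_∣ (leaves-double l) (leaves-double r)) (colless-double l) ⟩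
  ∣ 2 * leaves l - 2 * leaves r ∣ + 2 * colless l + colless (double r)
    ≡⟨ cong₂ (λ x y → x + 2 * colless l + y)
             (sym (*-distribˡ-∣-∣ 2 (leaves l) (leaves r))) (colless-double r) ⟩
  2 * d + 2 * colless l + 2 * colless r
    ≡⟨ cong (_+ 2 * colless r) (*-distribˡ-+ 2 d (colless l)) ⟨
  2 * (d + colless l) + 2 * colless r
    ≡⟨ *-distribˡ-+ 2 (d + colless l) (colless r) ⟨
  2 * (d + colless l + colless r)
    ∎
  where
  d : ℕ
  d = ∣ leaves l - leaves r ∣

leaves-positive : ∀ t → 1 ≤ leaves t
leaves-positive leaf       = s≤s z≤n
leaves-positive (node l r) = ≤-trans (leaves-positive l) (m≤m+n (leaves l) (leaves r))

colless-node-leaf : ∀ t → colless (node leaf t) ≡ colless t + (leaves t ∸ 1)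
colless-node-leaf t = begin
  ∣ 1 - leaves t ∣ + 0 + colless t    ≡⟨ cong (λ x → x + 0 + colless t) (m≤n⇒∣m-n∣≡n∸m (leaves-positive t)) ⟩
  leaves t ∸ 1 + 0 + colless t        ≡⟨ cong (_+ colless t) (+-identityʳ (leaves t ∸ 1)) ⟩
  leaves t ∸ 1 + colless t            ≡⟨ +-comm (leaves t ∸ 1) (colless t) ⟩
  colless t + (leaves t ∸ 1)          ∎

double-perfect : ∀ ρ → double (perfect ρ) ≡ perfect (suc ρ)
double-perfect zero    = refl
double-perfect (suc ρ) = cong₂ node (double-perfect ρ) (double-perfect ρ)

leaves-perfect : ∀ ρ → leaves (perfect ρ) ≡ 2 ^ ρ
leaves-perfect zero    = refl
leaves-perfect (suc ρ) = begin
  leaves (perfect (suc ρ))     ≡⟨ cong leaves (double-perfect ρ) ⟨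
  leaves (double (perfect ρ))  ≡⟨ leaves-double (perfect ρ) ⟩
  2 * leaves (perfect ρ)       ≡⟨ cong (2 *_) (leaves-perfect ρ) ⟩
  2 ^ suc ρ                    ∎

ladder-cons : ∀ ρ L → L ≢ [] → ladder (ρ ∷ L) ≡ node (perfect ρ) (ladder L)
ladder-cons ρ []      L≢[] = ⊥-elim (L≢[] refl)
ladder-cons ρ (σ ∷ L) _    = refl

ladder-map-suc : ∀ L → L ≢ [] → ladder (map suc L) ≡ double (ladder L)
ladder-map-suc []          L≢[] = ⊥-elim (L≢[] refl)
ladder-map-suc (ρ ∷ [])    _    = sym (double-perfect ρ)
ladder-map-suc (ρ ∷ σ ∷ L) _    = cong₂ node (sym (double-perfect ρ)) (ladder-map-suc (σ ∷ L) λ ())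

leaves-ladder : ∀ L → L ≢ [] → leaves (ladder L) ≡ sumPow2 L
leaves-ladder []          L≢[] = ⊥-elim (L≢[] refl)
leaves-ladder (ρ ∷ [])    _    = trans (leaves-perfect ρ) (sym (+-identityʳ (2 ^ ρ)))
leaves-ladder (ρ ∷ σ ∷ L) _    = cong₂ _+_ (leaves-perfect ρ) (leaves-ladder (σ ∷ L) λ ())

exps-nonempty : ∀ n → 1 ≤ n → exps n ≢ []
exps-nonempty n 1≤n exps≡[] = <⇒≢ 1≤n (sym n≡0)
  where
  n≡0 : n ≡ 0
  n≡0 = trans (sym (sumPow2-exps n)) (cong sumPow2 exps≡[])

leaves-ascMinD : ∀ n → 1 ≤ n → leaves (ascMinD n) ≡ n
leaves-ascMinD n 1≤n = trans (leaves-ladder (exps n) (exps-nonempty n 1≤n)) (sumPow2-exps n)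

ascMinD-2m : ∀ m → 1 ≤ m → ascMinD (2 * m) ≡ double (ascMinD m)
ascMinD-2m m 1≤m = trans (cong ladder (exps-2m m)) (ladder-map-suc (exps m) (exps-nonempty m 1≤m))

ascMinD-2m+1 : ∀ m → 1 ≤ m → ascMinD (2 * m + 1) ≡ node leaf (ascMinD (2 * m))
ascMinD-2m+1 m 1≤m = begin
  ladder (exps (2 * m + 1))           ≡⟨ cong ladder (exps-2m+1 m) ⟩
  ladder (0 ∷ map suc (exps m))       ≡⟨ cong (λ E → ladder (0 ∷ E)) (exps-2m m) ⟨
  ladder (0 ∷ exps (2 * m))           ≡⟨ ladder-cons 0 (exps (2 * m)) (exps-nonempty (2 * m) (≤-trans 1≤m (m≤2m m))) ⟩
  node leaf (ascMinD (2 * m))         ∎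

theorem99 : (m : ℕ) → 1 ≤ m →
    (c-asc (2 * m) ≡ 2 * c-asc m) × (c-asc (2 * m + 1) ≡ 2 * c-asc m + (2 * m ∸ 1))
theorem99 m 1≤m = c-asc-2m , c-asc-2m+1
  where
  c-asc-2m : c-asc (2 * m) ≡ 2 * c-asc m
  c-asc-2m = trans (cong colless (ascMinD-2m m 1≤m)) (colless-double (ascMinD m))

  c-asc-2m+1 : c-asc (2 * m + 1) ≡ 2 * c-asc m + (2 * m ∸ 1)
  c-asc-2m+1 = begin
    c-asc (2 * m + 1)                                  ≡⟨ cong colless (ascMinD-2m+1 m 1≤m) ⟩
    colless (node leaf (ascMinD (2 * m)))              ≡⟨ colless-node-leaf (ascMinD (2 * m)) ⟩
    c-asc (2 * m) + (leaves (ascMinD (2 * m)) ∸ 1)     ≡⟨ cong₂ _+_ c-asc-2m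
                                                           (cong (_∸ 1) (leaves-ascMinD (2 * m) (≤-trans 1≤m (m≤2m m)))) ⟩
    2 * c-asc m + (2 * m ∸ 1)                          ∎
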